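{- For every $d\in\mathbb{N}$, the sequences $(s_d(n))_{n\ge0}$ and $(r_d(n))_{n\ge0}$ are weakly increasing, where $r_d(n)$ (resp. $s_d(n)$) is the number of $d$-fold partition diamonds of size $n$ (resp. of Schmidt size $n$).
   Context: A $d$-fold partition diamond is a collection of non-negative integer sequences $\{a_k\}_{k\ge0}$ and $\{b_{j,k}\}_{k\ge0,\,0\le j\le d-1}$ (with only finitely many nonzero terms) such that for every $k\in\mathbb{N}_0$ one has $a_k\ge \max_{0\le j\le d-1} b_{j,k}\ge a_{k+1}$. Its size is $\sum_k a_k+\sum_{j,k}b_{j,k}$ and its Schmidt size is $\sum_k a_k$. -}

module Defs where

open import Data.Nat using (ℕ; zero; suc; _+_; _≤_; _⊔_)
open import Data.Fin using (Fin; zero; suc)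
open import Data.Product using (Σ; _×_; ∃; proj₁)
open import Relation.Binary.PropositionalEquality using (_≡_)

maxF : (n : ℕ) → (Fin n → ℕ) → ℕ
maxF zero    f = 0
maxF (suc n) f = f zero ⊔ maxF n (λ j → f (suc j))

sumTo : ℕ → (ℕ → ℕ) → ℕ
sumTo zero    f = 0
sumTo (suc N) f = sumTo N f + f N

sumF : (n : ℕ) → (Fin n → ℕ) → ℕ
sumF zero    f = 0
sumF (suc n) f = f zero + sumF n (λ j → f (suc j))

record Diamond (d : ℕ) : Set where
  field
    a     : ℕ → ℕ
    b     : Fin d → ℕ → ℕ
    bound : ℕ
    a-fin : ∀ k → bound ≤ k → a k ≡ 0
    b-fin : ∀ j k → bound ≤ k → b j k ≡ 0
    upper : ∀ k → maxF d (λ j → b j k) ≤ a k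
    lower : ∀ k → a (suc k) ≤ maxF d (λ j → b j k)

open Diamond public

-- Schmidt size: Σ_k a_k  (well defined since a vanishes from `bound` on)
schmidtSize : ∀ {d} → Diamond d → ℕ
schmidtSize x = sumTo (bound x) (a x)

size : ∀ {d} → Diamond d → ℕ
size {d} x = sumTo (bound x) (λ k → a x k + sumF d (λ j → b x j k))

_≈D_ : ∀ {d} → Diamond d → Diamond d → Set
x ≈D y = (∀ k → a x k ≡ a y k) × (∀ j k → b x j k ≡ b y j k)

-- a type X with an equivalence _≈_ has exactly m elements:
-- a bijection between Fin m and the quotient X/≈
HasCard : (X : Set) → (X → X → Set) → ℕ → Set
HasCard X _≈_ m =
  Σ (Fin m → X) λ f → Σ (X → Fin m) λ g →
    (∀ x y → x ≈ y → g x ≡ g y) ×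
    (∀ i → g (f i) ≡ i) ×
    (∀ x → f (g x) ≈ x)

SizeDiamond : ℕ → ℕ → Set
SizeDiamond d n = Σ (Diamond d) λ x → size x ≡ n

SchmidtDiamond : ℕ → ℕ → Set
SchmidtDiamond d n = Σ (Diamond d) λ x → schmidtSize x ≡ n

_≈S_ : ∀ {d n} → SizeDiamond d n → SizeDiamond d n → Set
x ≈S y = proj₁ x ≈D proj₁ y

_≈T_ : ∀ {d n} → SchmidtDiamond d n → SchmidtDiamond d n → Set
x ≈T y = proj₁ x ≈D proj₁ y

r-is : ℕ → ℕ → ℕ → Set
r-is d n m = HasCard (SizeDiamond d n) _≈S_ m

s-is : ℕ → ℕ → ℕ → Set
s-is d n m = HasCard (SchmidtDiamond d n) _≈T_ m

-- Finiteness: in a diamond of weight n the sequence a is weakly decreasing, so each a_k ≤ n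
-- and a_k = 0 for k ≥ n (otherwise a_0 + … + a_k ≥ k + 1 > n); all b_{j,k} ≤ a_k obey the same
-- bounds. A diamond of weight n is therefore determined by a (d+1) × n table with entries in
-- {0, …, n}, and the diamonds of weight n correspond to a decidable set of such tables.
-- Monotonicity: raising a_0 by one adds one to both sizes and is injective, so it embeds the
-- diamonds of weight n into those of weight n + 1.
module Submission where

open import Data.Bool using (Bool; true; false; T)
open import Data.Bool.Properties using (T-irrelevant)
open import Data.Empty using (⊥-elim)
open import Data.Fin using (Fin; zero; suc; toℕ; funToFin; finToFun; combine)
open import Data.Fin.Properties using (injective⇒≤; funToFin-finToFin; finToFun-funToFin)
open import Data.Nat using (ℕ; zero; suc; _+_; _^_; _≤_; _<_; _⊔_; z≤n; s≤s; _≤?_; _<?_; _≟_)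
open import Data.Nat.Properties
open import Data.Product using (Σ; _×_; _,_; proj₁; proj₂)
open import Data.Sum using (inj₁; inj₂)
open import Data.Unit using (tt)
open import Function using (_∘_)
open import Relation.Binary.Definitions using (Symmetric; Transitive)
open import Relation.Binary.PropositionalEquality
open import Relation.Nullary using (Dec; yes; no)
open import Relation.Nullary.Decidable using (⌊_⌋; toWitness; fromWitness; _×-dec_)
open import Defs

sumTo-cong : ∀ N {f g : ℕ → ℕ} → (∀ k → f k ≡ g k) → sumTo N f ≡ sumTo N g
sumTo-cong zero    f≡g = refl
sumTo-cong (suc N) f≡g = cong₂ _+_ (sumTo-cong N f≡g) (f≡g N)

sumTo-mono : ∀ N {f g : ℕ → ℕ} → (∀ k → f k ≤ g k) → sumTo N f ≤ sumTo N g
sumTo-mono zero    f≤g = z≤n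
sumTo-mono (suc N) f≤g = +-mono-≤ (sumTo-mono N f≤g) (f≤g N)

sumTo-monoˡ : ∀ K N (f : ℕ → ℕ) → sumTo N f ≤ sumTo (K + N) f
sumTo-monoˡ zero    N f = ≤-refl
sumTo-monoˡ (suc K) N f = ≤-trans (sumTo-monoˡ K N f) (m≤m+n _ _)

sumTo-beyond-support : ∀ {B} {f : ℕ → ℕ} → (∀ k → B ≤ k → f k ≡ 0) →
  ∀ K → sumTo (K + B) f ≡ sumTo B f
sumTo-beyond-support         f-vanish zero    = refl
sumTo-beyond-support {B} {f} f-vanish (suc K) = begin
  sumTo (K + B) f + f (K + B) ≡⟨ cong₂ _+_ (sumTo-beyond-support f-vanish K) (f-vanish _ (m≤n+m B K)) ⟩
  sumTo B f + 0               ≡⟨ +-identityʳ _ ⟩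
  sumTo B f                   ∎
  where open ≡-Reasoning

sumTo-≤-support : ∀ {B} {f : ℕ → ℕ} → (∀ k → B ≤ k → f k ≡ 0) → ∀ N → sumTo N f ≤ sumTo B f
sumTo-≤-support {B} {f} f-vanish N = begin
  sumTo N f       ≤⟨ sumTo-monoˡ B N f ⟩
  sumTo (B + N) f ≡⟨ cong (λ M → sumTo M f) (+-comm B N) ⟩
  sumTo (N + B) f ≡⟨ sumTo-beyond-support f-vanish N ⟩
  sumTo B f       ∎
  where open ≤-Reasoning

sumTo-support-irrelevant : ∀ {B B'} {f : ℕ → ℕ} →
  (∀ k → B ≤ k → f k ≡ 0) → (∀ k → B' ≤ k → f k ≡ 0) → sumTo B f ≡ sumTo B' f
sumTo-support-irrelevant {B} {B'} {f} f-vanish f-vanish' = begin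
  sumTo B f        ≡⟨ sumTo-beyond-support f-vanish B' ⟨
  sumTo (B' + B) f ≡⟨ cong (λ M → sumTo M f) (+-comm B' B) ⟩
  sumTo (B + B') f ≡⟨ sumTo-beyond-support f-vanish' B ⟩
  sumTo B' f       ∎
  where open ≡-Reasoning

sumTo-suc : ∀ N (f : ℕ → ℕ) → sumTo (suc N) f ≡ f 0 + sumTo N (f ∘ suc)
sumTo-suc zero    f = +-comm 0 (f 0)
sumTo-suc (suc N) f = trans (cong (_+ f (suc N)) (sumTo-suc N f)) (+-assoc (f 0) _ _)

sumTo-positive : ∀ N {f : ℕ → ℕ} → (∀ i → i < N → 1 ≤ f i) → N ≤ sumTo N f
sumTo-positive zero    f-pos = z≤n
sumTo-positive (suc N) {f} f-pos = subst (_≤ sumTo (suc N) f) (+-comm N 1)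
  (+-mono-≤ (sumTo-positive N (λ i i<N → f-pos i (m≤n⇒m≤1+n i<N))) (f-pos N ≤-refl))

sumF-cong : ∀ d {f g : Fin d → ℕ} → (∀ j → f j ≡ g j) → sumF d f ≡ sumF d g
sumF-cong zero    f≡g = refl
sumF-cong (suc d) f≡g = cong₂ _+_ (f≡g zero) (sumF-cong d (f≡g ∘ suc))

sumF-zero : ∀ d {f : Fin d → ℕ} → (∀ j → f j ≡ 0) → sumF d f ≡ 0
sumF-zero zero    f≡0 = refl
sumF-zero (suc d) f≡0 = cong₂ _+_ (f≡0 zero) (sumF-zero d (f≡0 ∘ suc))

maxF-ub : ∀ d (f : Fin d → ℕ) j → f j ≤ maxF d f
maxF-ub (suc d) f zero    = m≤m⊔n _ _
maxF-ub (suc d) f (suc j) = ≤-trans (maxF-ub d (f ∘ suc) j) (m≤n⊔m _ _)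

maxF-lub : ∀ d {f : Fin d → ℕ} {c} → (∀ j → f j ≤ c) → maxF d f ≤ c
maxF-lub zero    f≤c = z≤n
maxF-lub (suc d) f≤c = ⊔-lub (f≤c zero) (maxF-lub d (f≤c ∘ suc))

maxF-cong : ∀ d {f g : Fin d → ℕ} → (∀ j → f j ≡ g j) → maxF d f ≡ maxF d g
maxF-cong zero    f≡g = refl
maxF-cong (suc d) f≡g = cong₂ _⊔_ (f≡g zero) (maxF-cong d (f≡g ∘ suc))

record Enumeration {N : ℕ} (p : Fin N → Bool) : Set where
  field
    count       : ℕ
    index       : Fin count → Fin N
    index-valid : ∀ i → T (p (index i))
    rank        : ∀ j → T (p j) → Fin count
    index-rank  : ∀ j v → index (rank j v) ≡ j
    rank-index  : ∀ i v → rank (index i) v ≡ i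

enumerate-skip : ∀ {N} (p : Fin (suc N) → Bool) → p zero ≡ false →
  Enumeration (p ∘ suc) → Enumeration p
enumerate-skip p p0≡false E = record
  { count       = count
  ; index       = suc ∘ index
  ; index-valid = index-valid
  ; rank        = λ { zero v → ⊥-elim (subst T p0≡false v) ; (suc j) v → rank j v }
  ; index-rank  = λ { zero v → ⊥-elim (subst T p0≡false v) ; (suc j) v → cong suc (index-rank j v) }
  ; rank-index  = rank-index
  }
  where open Enumeration E

enumerate-keep : ∀ {N} (p : Fin (suc N) → Bool) → p zero ≡ true →
  Enumeration (p ∘ suc) → Enumeration p
enumerate-keep p p0≡true E = record
  { count       = suc count
  ; index       = λ { zero → zero ; (suc i) → suc (index i) }
  ; index-valid = λ { zero → subst T (sym p0≡true) tt ; (suc i) → index-valid i }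
  ; rank        = λ { zero v → zero ; (suc j) v → suc (rank j v) }
  ; index-rank  = λ { zero v → refl ; (suc j) v → cong suc (index-rank j v) }
  ; rank-index  = λ { zero v → refl ; (suc i) v → cong suc (rank-index i v) }
  }
  where open Enumeration E

enumerate : ∀ {N} (p : Fin N → Bool) → Enumeration p
enumerate {zero} p = record
  { count = 0 ; index = λ () ; index-valid = λ () ; rank = λ () ; index-rank = λ () ; rank-index = λ () }
enumerate {suc N} p with p zero in p0
... | false = enumerate-skip p p0 (enumerate (p ∘ suc))
... | true  = enumerate-keep p p0 (enumerate (p ∘ suc))

record FinCoding (X : Set) (_≈_ : X → X → Set) (N : ℕ) : Set where
  field
    valid         : Fin N → Bool
    encode        : X → Fin N
    encode-valid  : ∀ x → T (valid (encode x))
    encode-cong   : ∀ {x y} → x ≈ y → encode x ≡ encode y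
    decode        : ∀ c → T (valid c) → X
    encode-decode : ∀ c v → encode (decode c v) ≡ c
    decode-encode : ∀ x v → decode (encode x) v ≈ x

finCoding⇒hasCard : ∀ {X _≈_ N} → FinCoding X _≈_ N → Σ ℕ (HasCard X _≈_)
finCoding⇒hasCard {X} {_≈_} C =
  count , f , g , (λ x y x≈y → rank-cong _ _ (encode-cong x≈y)) , g∘f , f∘g
  where
  open FinCoding C
  open Enumeration (enumerate valid)

  rank-cong : ∀ {c c'} (v : T (valid c)) (v' : T (valid c')) → c ≡ c' → rank c v ≡ rank c' v'
  rank-cong v v' refl = cong (rank _) (T-irrelevant v v')

  decode-cong : ∀ {c c'} (v : T (valid c)) (v' : T (valid c')) → c ≡ c' → decode c v ≡ decode c' v'
  decode-cong v v' refl = cong (decode _) (T-irrelevant v v')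

  f : Fin count → X
  f i = decode (index i) (index-valid i)

  g : X → Fin count
  g x = rank (encode x) (encode-valid x)

  g∘f : ∀ i → g (f i) ≡ i
  g∘f i = trans (rank-cong _ (index-valid i) (encode-decode _ _)) (rank-index i _)

  f∘g : ∀ x → f (g x) ≈ x
  f∘g x = subst (_≈ x) (decode-cong _ _ (sym (index-rank _ _))) (decode-encode x (encode-valid x))

card-mono : ∀ {X Y : Set} {_≈_ : X → X → Set} {_~_ : Y → Y → Set} {m m'} →
  Symmetric _~_ → Transitive _~_ →
  (h : X → Y) → (∀ {x y} → h x ~ h y → x ≈ y) →
  HasCard X _≈_ m → HasCard Y _~_ m' → m ≤ m'
card-mono {_~_ = _~_} ~-sym ~-trans h h-reflects (f , g , g-cong , g∘f , _) (f' , g' , _ , _ , f'∘g') =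
  injective⇒≤ injective
  where
  injective : ∀ {i j} → g' (h (f i)) ≡ g' (h (f j)) → i ≡ j
  injective {i} {j} eq = begin
    i         ≡⟨ g∘f i ⟨
    g (f i)   ≡⟨ g-cong _ _ (h-reflects hfi~hfj) ⟩
    g (f j)   ≡⟨ g∘f j ⟩
    j         ∎
    where
    open ≡-Reasoning
    hfi~hfj : h (f i) ~ h (f j)
    hfi~hfj = ~-trans (~-sym (f'∘g' _)) (subst (λ c → f' c ~ h (f j)) (sym eq) (f'∘g' _))

clamp : (B : ℕ) → ℕ → Fin (suc B)
clamp B       zero    = zero
clamp zero    (suc x) = zero
clamp (suc B) (suc x) = suc (clamp B x)

toℕ-clamp : ∀ {B x} → x ≤ B → toℕ (clamp B x) ≡ x
toℕ-clamp {B}     {zero}  _         = refl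
toℕ-clamp {suc B} {suc x} (s≤s x≤B) = cong suc (toℕ-clamp x≤B)

clamp-toℕ : ∀ {B} (i : Fin (suc B)) → clamp B (toℕ i) ≡ i
clamp-toℕ         zero    = refl
clamp-toℕ {suc B} (suc i) = cong suc (clamp-toℕ i)

extendByZero : ∀ {L M} → (Fin L → Fin M) → ℕ → ℕ
extendByZero {zero}  g k       = 0
extendByZero {suc L} g zero    = toℕ (g zero)
extendByZero {suc L} g (suc k) = extendByZero (g ∘ suc) k

restrict : (B : ℕ) → ∀ {L} → (ℕ → ℕ) → Fin L → Fin (suc B)
restrict B f i = clamp B (f (toℕ i))

extendByZero-toℕ : ∀ {L M} (g : Fin L → Fin M) i → extendByZero g (toℕ i) ≡ toℕ (g i)
extendByZero-toℕ g zero    = refl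
extendByZero-toℕ g (suc i) = extendByZero-toℕ (g ∘ suc) i

extendByZero-vanishes : ∀ {L M} (g : Fin L → Fin M) k → L ≤ k → extendByZero g k ≡ 0
extendByZero-vanishes {zero}  g k       _       = refl
extendByZero-vanishes {suc L} g (suc k) (s≤s L≤k) = extendByZero-vanishes (g ∘ suc) k L≤k

extendByZero-cong : ∀ {L M} {g g' : Fin L → Fin M} → g ≗ g' → extendByZero g ≗ extendByZero g'
extendByZero-cong {zero}  g≗g' k       = refl
extendByZero-cong {suc L} g≗g' zero    = cong toℕ (g≗g' zero)
extendByZero-cong {suc L} g≗g' (suc k) = extendByZero-cong (g≗g' ∘ suc) k

restrict-extendByZero : ∀ {B L} (g : Fin L → Fin (suc B)) → restrict B (extendByZero g) ≗ g
restrict-extendByZero {B} g i = trans (cong (clamp B) (extendByZero-toℕ g i)) (clamp-toℕ (g i))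

extendByZero-restrict : ∀ L {B} {f : ℕ → ℕ} → (∀ k → f k ≤ B) → (∀ k → L ≤ k → f k ≡ 0) →
  ∀ k → extendByZero (restrict B {L} f) k ≡ f k
extendByZero-restrict zero    f≤B f-vanish k       = sym (f-vanish k z≤n)
extendByZero-restrict (suc L) f≤B f-vanish zero    = toℕ-clamp (f≤B 0)
extendByZero-restrict (suc L) f≤B f-vanish (suc k) =
  extendByZero-restrict L (f≤B ∘ suc) (λ k L≤k → f-vanish (suc k) (s≤s L≤k)) k

funToFin-cong : ∀ {m n} {f g : Fin m → Fin n} → f ≗ g → funToFin f ≡ funToFin g
funToFin-cong {zero}  f≗g = refl
funToFin-cong {suc m} f≗g = cong₂ combine (f≗g zero) (funToFin-cong (f≗g ∘ suc))

Table : ℕ → Set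
Table d = Fin (suc d) → ℕ → ℕ

TableCode : ℕ → ℕ → Set
TableCode d n = Fin ((suc n ^ n) ^ suc d)

module _ {d : ℕ} where

  encodeRow : ∀ n → (ℕ → ℕ) → Fin (suc n ^ n)
  encodeRow n f = funToFin {n} {suc n} (restrict n f)

  decodeRow : ∀ n → Fin (suc n ^ n) → ℕ → ℕ
  decodeRow n r = extendByZero (finToFun {suc n} {n} r)

  encodeTable : ∀ n → Table d → TableCode d n
  encodeTable n t = funToFin {suc d} {suc n ^ n} (λ j → encodeRow n (t j))

  decodeTable : ∀ n → TableCode d n → Table d
  decodeTable n c j = decodeRow n (finToFun {suc n ^ n} {suc d} c j)

  encodeTable-cong : ∀ n {t t' : Table d} → (∀ j k → t j k ≡ t' j k) → encodeTable n t ≡ encodeTable n t'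
  encodeTable-cong n t≡t' =
    funToFin-cong {suc d} {suc n ^ n} (λ j → funToFin-cong {n} {suc n} (λ i → cong (clamp n) (t≡t' j (toℕ i))))

  decodeTable-vanishes : ∀ n (c : TableCode d n) j k → n ≤ k → decodeTable n c j k ≡ 0
  decodeTable-vanishes n c j = extendByZero-vanishes (finToFun {suc n} {n} (finToFun {suc n ^ n} {suc d} c j))

  encodeRow-decodeRow : ∀ n (r : Fin (suc n ^ n)) → encodeRow n (decodeRow n r) ≡ r
  encodeRow-decodeRow n r =
    trans (funToFin-cong {n} {suc n} (restrict-extendByZero (finToFun r))) (funToFin-finToFin {n} {suc n} r)

  decodeRow-encodeRow : ∀ n {f : ℕ → ℕ} → (∀ k → f k ≤ n) → (∀ k → n ≤ k → f k ≡ 0) →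
    ∀ k → decodeRow n (encodeRow n f) k ≡ f k
  decodeRow-encodeRow n {f} f≤n f-vanish k =
    trans (extendByZero-cong (finToFun-funToFin (restrict n {n} f)) k) (extendByZero-restrict n f≤n f-vanish k)

  encodeTable-decodeTable : ∀ n (c : TableCode d n) → encodeTable n (decodeTable n c) ≡ c
  encodeTable-decodeTable n c =
    trans (funToFin-cong {suc d} {suc n ^ n} (λ j → encodeRow-decodeRow n (finToFun c j)))
          (funToFin-finToFin {suc d} {suc n ^ n} c)

  decodeTable-encodeTable : ∀ n {t : Table d} → (∀ j k → t j k ≤ n) → (∀ j k → n ≤ k → t j k ≡ 0) →
    ∀ j k → decodeTable n (encodeTable n t) j k ≡ t j k
  decodeTable-encodeTable n {t} t≤n t-vanish j k =
    trans (cong (λ r → decodeRow n r k) (finToFun-funToFin (λ j → encodeRow n (t j)) j))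
          (decodeRow-encodeRow n (t≤n j) (t-vanish j) k)

raiseHead : (ℕ → ℕ) → ℕ → ℕ
raiseHead α zero    = suc (α zero)
raiseHead α (suc k) = α (suc k)

module _ {d : ℕ} where

  ≈D-sym : Symmetric (_≈D_ {d})
  ≈D-sym (a≡ , b≡) = sym ∘ a≡ , λ j → sym ∘ b≡ j

  ≈D-trans : Transitive (_≈D_ {d})
  ≈D-trans (a≡ , b≡) (a≡' , b≡') = (λ k → trans (a≡ k) (a≡' k)) , λ j k → trans (b≡ j k) (b≡' j k)

  table : Diamond d → Table d
  table x zero    = a x
  table x (suc j) = b x j

  b≤a : (x : Diamond d) → ∀ j k → b x j k ≤ a x k
  b≤a x j k = ≤-trans (maxF-ub d (λ j → b x j k) j) (upper x k)

  table≤a : (x : Diamond d) → ∀ j k → table x j k ≤ a x k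
  table≤a x zero    k = ≤-refl
  table≤a x (suc j) k = b≤a x j k

  a-antitone : (x : Diamond d) → ∀ {i k} → i ≤ k → a x k ≤ a x i
  a-antitone x {i} {zero}  z≤n  = ≤-refl
  a-antitone x {i} {suc k} i≤sk with m≤n⇒m<n∨m≡n i≤sk
  ... | inj₁ (s≤s i≤k) = ≤-trans (≤-trans (lower x k) (upper x k)) (a-antitone x i≤k)
  ... | inj₂ refl      = ≤-refl

  Interlaced : (ℕ → ℕ) → (Fin d → ℕ → ℕ) → ℕ → Set
  Interlaced α β k = maxF d (λ j → β j k) ≤ α k × α (suc k) ≤ maxF d (λ j → β j k)

  interlaced? : ∀ α β k → Dec (Interlaced α β k)
  interlaced? α β k = (maxF d (λ j → β j k) ≤? α k) ×-dec (α (suc k) ≤? maxF d (λ j → β j k))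

  Interlaced-cong : ∀ {α α' β β'} → (∀ k → α k ≡ α' k) → (∀ j k → β j k ≡ β' j k) →
    ∀ k → Interlaced α β k → Interlaced α' β' k
  Interlaced-cong α≡ β≡ k (max≤α , α≤max) =
    subst₂ _≤_ max≡ (α≡ k) max≤α , subst₂ _≤_ (α≡ (suc k)) max≡ α≤max
    where max≡ = maxF-cong d (λ j → β≡ j k)

  raiseHead-diamond : Diamond d → Diamond d
  raiseHead-diamond x = record
    { a     = raiseHead (a x)
    ; b     = b x
    ; bound = suc (bound x)
    ; a-fin = λ { zero () ; (suc k) (s≤s B≤k) → a-fin x (suc k) (m≤n⇒m≤1+n B≤k) }
    ; b-fin = λ j k sB≤k → b-fin x j k (≤-trans (n≤1+n _) sB≤k)
    ; upper = λ { zero → m≤n⇒m≤1+n (upper x 0) ; (suc k) → upper x (suc k) }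
    ; lower = lower x
    }

  raiseHead-reflects : ∀ {x y} → raiseHead-diamond x ≈D raiseHead-diamond y → x ≈D y
  raiseHead-reflects (a≡ , b≡) = (λ { zero → suc-injective (a≡ 0) ; (suc k) → a≡ (suc k) }) , b≡

-- The contribution of one column (a_k, b_{0,k}, …, b_{d-1,k}) to a size.
record ColumnWeight (d : ℕ) : Set where
  field
    weight       : ℕ → (Fin d → ℕ) → ℕ
    weight-congʳ : ∀ α {β β'} → (∀ j → β j ≡ β' j) → weight α β ≡ weight α β'
    ≤-weight     : ∀ α β → α ≤ weight α β
    weight-zero  : weight 0 (λ _ → 0) ≡ 0
    weight-suc   : ∀ α β → weight (suc α) β ≡ suc (weight α β)

schmidtWeight : ∀ d → ColumnWeight d
schmidtWeight d = record
  { weight       = λ α β → α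
  ; weight-congʳ = λ α _ → refl
  ; ≤-weight     = λ α β → ≤-refl
  ; weight-zero  = refl
  ; weight-suc   = λ α β → refl
  }

sizeWeight : ∀ d → ColumnWeight d
sizeWeight d = record
  { weight       = λ α β → α + sumF d β
  ; weight-congʳ = λ α β≡β' → cong (α +_) (sumF-cong d β≡β')
  ; ≤-weight     = λ α β → m≤m+n α (sumF d β)
  ; weight-zero  = sumF-zero d (λ _ → refl)
  ; weight-suc   = λ α β → refl
  }

module Counting {d : ℕ} (W : ColumnWeight d) where
  open ColumnWeight W

  columnWeight : (ℕ → ℕ) → (Fin d → ℕ → ℕ) → ℕ → ℕ
  columnWeight α β k = weight (α k) (λ j → β j k)

  columnWeight-cong : ∀ {α α' β β'} → (∀ k → α k ≡ α' k) → (∀ j k → β j k ≡ β' j k) →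
    ∀ k → columnWeight α β k ≡ columnWeight α' β' k
  columnWeight-cong {β' = β'} α≡ β≡ k =
    trans (weight-congʳ _ (λ j → β≡ j k)) (cong (λ c → weight c (λ j → β' j k)) (α≡ k))

  columnWeight-vanishes : (x : Diamond d) → ∀ k → bound x ≤ k → columnWeight (a x) (b x) k ≡ 0
  columnWeight-vanishes x k B≤k =
    trans (columnWeight-cong {α' = λ _ → 0} {β' = λ _ _ → 0}
            (λ _ → a-fin x k B≤k) (λ j _ → b-fin x j k B≤k) k)
          weight-zero

  weightOf : Diamond d → ℕ
  weightOf x = sumTo (bound x) (columnWeight (a x) (b x))

  DiamondOfWeight : ℕ → Set
  DiamondOfWeight n = Σ (Diamond d) λ x → weightOf x ≡ n

  _≈W_ : ∀ {n} → DiamondOfWeight n → DiamondOfWeight n → Set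
  x ≈W y = proj₁ x ≈D proj₁ y

  module Bounds {n : ℕ} (x : Diamond d) (weight≡n : weightOf x ≡ n) where

    sumTo-a≤n : ∀ N → sumTo N (a x) ≤ n
    sumTo-a≤n N = begin
      sumTo N (a x)                              ≤⟨ sumTo-≤-support (a-fin x) N ⟩
      sumTo (bound x) (a x)                      ≤⟨ sumTo-mono (bound x) (λ k → ≤-weight _ _) ⟩
      sumTo (bound x) (columnWeight (a x) (b x)) ≡⟨ weight≡n ⟩
      n                                          ∎
      where open ≤-Reasoning

    a≤n : ∀ k → a x k ≤ n
    a≤n k = ≤-trans (m≤n+m (a x k) (sumTo k (a x))) (sumTo-a≤n (suc k))

    a-vanishes : ∀ k → n ≤ k → a x k ≡ 0
    a-vanishes k n≤k = n<1⇒n≡0 (≰⇒> λ 1≤ak → <⇒≱ (s≤s n≤k)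
      (≤-trans (sumTo-positive (suc k) (λ i i<sk → ≤-trans 1≤ak (a-antitone x (≤-pred i<sk))))
               (sumTo-a≤n (suc k))))

    table≤n : ∀ j k → table x j k ≤ n
    table≤n j k = ≤-trans (table≤a x j k) (a≤n k)

    table-vanishes : ∀ j k → n ≤ k → table x j k ≡ 0
    table-vanishes j k n≤k = n≤0⇒n≡0 (subst (table x j k ≤_) (a-vanishes k n≤k) (table≤a x j k))

  Admissible : ℕ → Table d → Set
  Admissible n t = (∀ {k} → k < n → Interlaced (t zero) (t ∘ suc) k)
                 × sumTo n (columnWeight (t zero) (t ∘ suc)) ≡ n

  admissible? : ∀ n t → Dec (Admissible n t)
  admissible? n t = allUpTo? (interlaced? (t zero) (t ∘ suc)) n
              ×-dec (sumTo n (columnWeight (t zero) (t ∘ suc)) ≟ n)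

  fromTable : ∀ n (t : Table d) → (∀ j k → n ≤ k → t j k ≡ 0) → Admissible n t → DiamondOfWeight n
  fromTable n t t-vanish (interlaced , weight≡n) = x , weight≡n
    where
    x : Diamond d
    x = record
      { a     = t zero
      ; b     = t ∘ suc
      ; bound = n
      ; a-fin = t-vanish zero
      ; b-fin = t-vanish ∘ suc
      ; upper = λ k → upper' k (k <? n)
      ; lower = λ k → lower' k (k <? n)
      }
      where
      upper' : ∀ k → Dec (k < n) → maxF d (λ j → t (suc j) k) ≤ t zero k
      upper' k (yes k<n) = proj₁ (interlaced k<n)
      upper' k (no k≮n)  = maxF-lub d (λ j → ≤-trans (≤-reflexive (t-vanish (suc j) k (≮⇒≥ k≮n))) z≤n)
      lower' : ∀ k → Dec (k < n) → t zero (suc k) ≤ maxF d (λ j → t (suc j) k)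
      lower' k (yes k<n) = proj₂ (interlaced k<n)
      lower' k (no k≮n)  = ≤-trans (≤-reflexive (t-vanish zero (suc k) (m≤n⇒m≤1+n (≮⇒≥ k≮n)))) z≤n

  diamondCoding : ∀ n → FinCoding (DiamondOfWeight n) _≈W_ ((suc n ^ n) ^ suc d)
  diamondCoding n = record
    { valid         = λ c → ⌊ admissible? n (decodeTable n c) ⌋
    ; encode        = λ (x , _) → encodeTable n (table x)
    ; encode-valid  = λ (x , weight≡n) → fromWitness (encode-admissible x weight≡n)
    ; encode-cong   = λ {x} {y} (a≡ , b≡) →
                        encodeTable-cong n {table (proj₁ x)} {table (proj₁ y)} (λ { zero → a≡ ; (suc j) → b≡ j })
    ; decode        = decode
    ; encode-decode = λ c v → trans (encodeTable-cong n {table (proj₁ (decode c v))} {decodeTable n c}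
                                      (λ { zero k → refl ; (suc j) k → refl }))
                                    (encodeTable-decodeTable {d} n c)
    ; decode-encode = λ (x , weight≡n) _ → decode-encode x weight≡n zero , decode-encode x weight≡n ∘ suc
    }
    where
    decode : ∀ c → T ⌊ admissible? n (decodeTable n c) ⌋ → DiamondOfWeight n
    decode c v = fromTable n (decodeTable n c) (decodeTable-vanishes n c) (toWitness v)

    decode-encode : (x : Diamond d) → weightOf x ≡ n →
      ∀ j k → decodeTable n (encodeTable n (table x)) j k ≡ table x j k
    decode-encode x weight≡n = decodeTable-encodeTable n table≤n table-vanishes
      where open Bounds x weight≡n

    encode-admissible : (x : Diamond d) → weightOf x ≡ n →
      Admissible n (decodeTable n (encodeTable n (table x)))
    encode-admissible x weight≡n =
        (λ {k} _ → Interlaced-cong (λ k → sym (t≡ zero k)) (λ j k → sym (t≡ (suc j) k)) k (upper x k , lower x k))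
      , (begin
          sumTo n (columnWeight (t zero) (t ∘ suc))
            ≡⟨ sumTo-cong n (columnWeight-cong (t≡ zero) (t≡ ∘ suc)) ⟩
          sumTo n (columnWeight (a x) (b x))
            ≡⟨ sumTo-support-irrelevant column-vanishes (columnWeight-vanishes x) ⟩
          weightOf x
            ≡⟨ weight≡n ⟩
          n ∎)
      where
      open ≡-Reasoning
      open Bounds x weight≡n
      t = decodeTable n (encodeTable n (table x))
      t≡ = decode-encode x weight≡n
      column-vanishes : ∀ k → n ≤ k → columnWeight (a x) (b x) k ≡ 0
      column-vanishes k n≤k =
        trans (columnWeight-cong {α' = λ _ → 0} {β' = λ _ _ → 0}
                (λ _ → a-vanishes k n≤k) (λ j _ → table-vanishes (suc j) k n≤k) k)
              weight-zero

  raiseHead-weight : ∀ {n} → DiamondOfWeight n → DiamondOfWeight (suc n)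
  raiseHead-weight {n} (x , weight≡n) = raiseHead-diamond x , (begin
    sumTo (suc (bound x)) (columnWeight (raiseHead (a x)) (b x))
      ≡⟨ sumTo-suc (bound x) (columnWeight (raiseHead (a x)) (b x)) ⟩
    weight (suc (a x 0)) (λ j → b x j 0) + sumTo (bound x) (columnWeight (a x) (b x) ∘ suc)
      ≡⟨ cong (_+ sumTo (bound x) (columnWeight (a x) (b x) ∘ suc)) (weight-suc _ _) ⟩
    suc (columnWeight (a x) (b x) 0 + sumTo (bound x) (columnWeight (a x) (b x) ∘ suc))
      ≡⟨ cong suc (sumTo-suc (bound x) _) ⟨
    suc (sumTo (suc (bound x)) (columnWeight (a x) (b x)))
      ≡⟨ cong suc (sumTo-beyond-support (columnWeight-vanishes x) 1) ⟩
    suc (weightOf x)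
      ≡⟨ cong suc weight≡n ⟩
    suc n ∎)
    where open ≡-Reasoning

  counts-mono : ∀ n → Σ ℕ λ m → Σ ℕ λ m' →
    HasCard (DiamondOfWeight n) _≈W_ m × HasCard (DiamondOfWeight (suc n)) _≈W_ m' × m ≤ m'
  counts-mono n = m , m' , card , card' ,
    card-mono (λ {x y} → ≈D-sym {d} {proj₁ x} {proj₁ y}) (λ {x y z} → ≈D-trans {d} {proj₁ x} {proj₁ y} {proj₁ z})
      raiseHead-weight (λ {x y} → raiseHead-reflects {d} {proj₁ x} {proj₁ y}) card card'
    where
    open Σ (finCoding⇒hasCard (diamondCoding n)) renaming (proj₁ to m; proj₂ to card)
    open Σ (finCoding⇒hasCard (diamondCoding (suc n))) renaming (proj₁ to m'; proj₂ to card')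

lemma2p4 : (d n : ℕ) →
    (Σ ℕ λ m → Σ ℕ λ m' → s-is d n m × s-is d (suc n) m' × m ≤ m')
    × (Σ ℕ λ m → Σ ℕ λ m' → r-is d n m × r-is d (suc n) m' × m ≤ m')
lemma2p4 d n = Counting.counts-mono (schmidtWeight d) n , Counting.counts-mono (sizeWeight d) n
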